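{- Consider the periodic tiling of $\mathbb{R}^2$ by regular hexagons of side length $1$ whose centers form the lattice $\Lambda=\mathbb{Z}(0,\sqrt3)+\mathbb{Z}(3/2,\sqrt3/2)$, and let $G$ be its graph (vertices: hexagon corners; edges: hexagon sides). Let $M=\mathbb{Z}(3/2,5\sqrt3/2)+\mathbb{Z}(9/2,\sqrt3/2)\subset\Lambda$ (a sublattice of index $7$). For $m\in M$ the flower $F_m$ is the union of the hexagon $H_m$ centered at $m$ and its six neighbouring hexagons; the flowers $F_m$, $m\in M$, cover the plane and have disjoint interiors. Each vertex $p$ of a central hexagon $H_m$ is incident to exactly one edge not belonging to $H_m$ (a spoke), which lies inside $F_m$. Define $w:E\to\{1,2,3\}$ by: every side of every central hexagon $H_m$ has weight $2$; going around $H_m$, the six spokes of $H_m$ alternately have weight $2$ and $3$, and this choice is the same in every flower, i.e. $w$ is invariant under translations by $M$; every remaining edge (these are exactly the edges lying on the common boundary of two distinct flowers) has weight $1$. Then $w$ is a solution to the 1-2-3 problem for $G$.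
   Context: For a graph $G=(V,E)$ and $w:E\to\{1,2,3\}$, the weighted degree of a vertex $p$ is $s_w(p)=\sum_{pq\in E}w(pq)$; $w$ is a solution to the 1-2-3 problem if $s_w(p)\neq s_w(q)$ for every edge $pq$. -}

module Defs where

open import Data.Nat using (ℕ; _+_)
open import Data.Integer using (ℤ; +_; -[1+_]) renaming (_+_ to _+ℤ_; _*_ to _*ℤ_; _-_ to _-ℤ_)
open import Data.Integer.DivMod using (_%ℕ_)
open import Data.Fin using (Fin; zero; suc)
open import Data.Bool using (Bool; true; false; if_then_else_)
open import Data.Product using (_×_; _,_; Σ; ∃; ∃-syntax; proj₁; proj₂)
open import Data.Sum using (_⊎_)
open import Relation.Binary.PropositionalEquality using (_≡_; _≢_)
open import Relation.Nullary using (¬_)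

-- A point (x , y) : ℤ × ℤ stands for the point
--   x · (1 , 0) + y · (1/2 , √3/2)   of ℝ²,
-- i.e. points of the triangular lattice T = ℤ(1,0) + ℤ(1/2,√3/2).
-- All hexagon centres and all hexagon corners of the tiling lie in T.
Point : Set
Point = ℤ × ℤ

_⊕_ : Point → Point → Point
(a , b) ⊕ (c , d) = (a +ℤ c , b +ℤ d)

infixl 6 _⊕_
infixl 7 _·_

_·_ : ℤ → Point → Point
k · (a , b) = (k *ℤ a , k *ℤ b)

-- The six unit vectors, in counter-clockwise cyclic order
-- (angles 0°, 60°, 120°, 180°, 240°, 300°):
-- (1,0), (1/2,√3/2), (-1/2,√3/2), (-1,0), (-1/2,-√3/2), (1/2,-√3/2).
δ : Fin 6 → Point
δ zero                            = (+ 1 , + 0)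
δ (suc zero)                      = (+ 0 , + 1)
δ (suc (suc zero))                = (-[1+ 0 ] , + 1)
δ (suc (suc (suc zero)))          = (-[1+ 0 ] , + 0)
δ (suc (suc (suc (suc zero))))    = (+ 0 , -[1+ 0 ])
δ (suc (suc (suc (suc (suc zero))))) = (+ 1 , -[1+ 0 ])

next : Fin 6 → Fin 6
next zero                            = suc zero
next (suc zero)                      = suc (suc zero)
next (suc (suc zero))                = suc (suc (suc zero))
next (suc (suc (suc zero)))          = suc (suc (suc (suc zero)))
next (suc (suc (suc (suc zero))))    = suc (suc (suc (suc (suc zero))))
next (suc (suc (suc (suc (suc zero))))) = zero

-- Hexagon centres: the lattice Λ = ℤ(0,√3) + ℤ(3/2,√3/2).
-- In our coordinates (0,√3) = (-1,2) and (3/2,√3/2) = (1,1), and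
-- Λ = ℤ(-1,2) + ℤ(1,1) = { (x,y) ∈ ℤ² : x ≡ y (mod 3) }.
centreMod : Point → ℕ
centreMod (x , y) = (x -ℤ y) %ℕ 3

-- Hexagon corners = points of T not in Λ (the vertices of G).
isCorner : Point → Bool
isCorner p with centreMod p
... | 0 = false
... | _ = true

IsCorner : Point → Set
IsCorner p = isCorner p ≡ true

-- Edges of G: hexagon sides, i.e. pairs of corners at distance 1.
Adj : Point → Point → Set
Adj p q = IsCorner p × IsCorner q × Σ (Fin 6) (λ j → q ≡ p ⊕ δ j)

-- The sublattice M = ℤ(3/2,5√3/2) + ℤ(9/2,√3/2);
-- in our coordinates (3/2,5√3/2) = (-1,5) and (9/2,√3/2) = (4,1).
InM : Point → Set
InM p = ∃[ a ] ∃[ b ] (p ≡ a · (-[1+ 0 ] , + 5) ⊕ b · (+ 4 , + 1))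

SameEdge : Point → Point → Point → Point → Set
SameEdge p q a b = (p ≡ a × q ≡ b) ⊎ (p ≡ b × q ≡ a)

CentralSide : Point → Point → Set
CentralSide p q = ∃[ m ] ∃[ i ] (InM m × SameEdge p q (m ⊕ δ i) (m ⊕ δ (next i)))

-- The spoke of H_m at its corner m + δ i is the edge from m + δ i to m + 2 δ i
-- (the unique edge at that corner not belonging to H_m).
spokeEnd : Point → Fin 6 → Point
spokeEnd m i = m ⊕ δ i ⊕ δ i

IsSpoke : Point → Point → Set
IsSpoke p q = ∃[ m ] ∃[ i ] (InM m × SameEdge p q (m ⊕ δ i) (spokeEnd m i))

evenIdx : Fin 6 → Bool
evenIdx zero                            = true
evenIdx (suc zero)                      = false
evenIdx (suc (suc zero))                = true
evenIdx (suc (suc (suc zero)))          = false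
evenIdx (suc (suc (suc (suc zero))))    = true
evenIdx (suc (suc (suc (suc (suc zero))))) = false

spokeWeight : Bool → Fin 6 → ℕ
spokeWeight true  i = if evenIdx i then 2 else 3
spokeWeight false i = if evenIdx i then 3 else 2

-- The weighting w of the paper, given as a function on ordered pairs of points
-- (only its values on edges matter), pinned down by the paper's description;
-- one global alternation choice b (same in every flower, i.e. M-invariance).
IsPaperWeighting : (Point → Point → ℕ) → Set
IsPaperWeighting w =
  Σ Bool λ b →
    (∀ p q → Adj p q → CentralSide p q → w p q ≡ 2)
  × (∀ m i → InM m → w (m ⊕ δ i) (spokeEnd m i) ≡ spokeWeight b i
                   × w (spokeEnd m i) (m ⊕ δ i) ≡ spokeWeight b i)
  × (∀ p q → Adj p q → ¬ CentralSide p q → ¬ IsSpoke p q → w p q ≡ 1)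

-- Weighted degree s_w(p) = Σ_{pq ∈ E} w(pq): the neighbours of a corner p are
-- exactly the points p + δ j that are corners.
s : (Point → Point → ℕ) → Point → ℕ
s w p = t zero + t (suc zero) + t (suc (suc zero)) + t (suc (suc (suc zero)))
        + t (suc (suc (suc (suc zero)))) + t (suc (suc (suc (suc (suc zero)))))
  where
  t : Fin 6 → ℕ
  t j = if isCorner (p ⊕ δ j) then w p (p ⊕ δ j) else 0

Solution123 : (Point → Point → ℕ) → Set
Solution123 w =
    (∀ p q → Adj p q → (w p q ≡ 1 ⊎ w p q ≡ 2 ⊎ w p q ≡ 3))
  × (∀ p q → Adj p q → s w p ≢ s w q)

-- Since w is invariant under the sublattice M, the weight of an edge and the weighted degree
-- of a corner depend only on the class of the corner modulo M.  The map (x , y) ↦ x + 17 y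
-- identifies the quotient of the lattice T = ℤ² of hexagon centres and corners by M with ℤ/21,
-- and reading off the type of every edge (side of a central hexagon, spoke, or boundary edge)
-- from residues turns the theorem into a check of the 21 residues and 6 directions.
module Submission where

open import Defs
open import Algebra.Bundles using (AbelianGroup)
open import Data.Bool as Bool using (Bool; true; false; not; if_then_else_)
open import Data.Fin using (Fin; zero; suc) renaming (_≟_ to _≟ᶠ_)
open import Data.Fin.Properties using (all?)
open import Data.Integer as ℤ using (+_; -1ℤ; _+_; _-_; _*_; _⊖_; ∣_∣)
open import Data.Integer.DivMod using (_%ℕ_; _/ℕ_; a≡a%ℕn+[a/ℕn]*n; n%ℕd<d)
import Data.Integer.Properties as ℤP
open import Data.Integer.Tactic.RingSolver using (solve-∀)
open import Data.Nat as ℕ using (ℕ; zero; suc; NonZero; _<_; _≟_)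
open import Data.Nat.DivMod using (m<n⇒m%n≡m)
open import Data.Nat.Divisibility using (_∣_; divides; >⇒∤)
import Data.Nat.Properties as ℕP
open import Data.Product using (_×_; _,_; ∃-syntax; proj₁; proj₂)
open import Data.Product.Properties using (≡-dec)
open import Data.Sum using (_⊎_; inj₁; inj₂)
open import Relation.Binary.Definitions using (DecidableEquality)
open import Relation.Binary.PropositionalEquality
open import Relation.Nullary using (¬_; Dec; yes; no; ¬?; contradiction)
open import Relation.Nullary.Decidable using (from-yes; _→-dec_)

open import Algebra.Properties.Group (AbelianGroup.group ℤP.+-0-abelianGroup) using (∙-cancelˡ)

∣m⊖n∣≡∣m-n∣ : ∀ m n → ∣ m ⊖ n ∣ ≡ ℕ.∣ m - n ∣
∣m⊖n∣≡∣m-n∣ m n with ℕP.≤-total m n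
... | inj₁ m≤n = trans (ℤP.∣⊖∣-≤ m≤n) (sym (ℕP.m≤n⇒∣m-n∣≡n∸m m≤n))
... | inj₂ n≤m = trans (ℤP.∣m⊖n∣≡∣n⊖m∣ m n) (trans (ℤP.∣⊖∣-≤ n≤m) (sym (ℕP.m≤n⇒∣n-m∣≡n∸m n≤m)))

n∣∣k-l∣⇒k≡l : ∀ {n k l} → k < n → l < n → n ∣ ℕ.∣ k - l ∣ → k ≡ l
n∣∣k-l∣⇒k≡l {n} {k} {l} k<n l<n n∣ with ℕ.∣ k - l ∣ in eq
... | zero  = ℕP.∣m-n∣≡0⇒m≡n eq
... | suc _ = contradiction n∣ (>⇒∤ (subst (_< n) eq
                (ℕP.≤-<-trans (ℕP.∣m-n∣≤m⊔n k l) (ℕP.⊔-pres-<m k<n l<n))))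

%ℕ-cong : ∀ d .{{_ : NonZero d}} {a} b t → a ≡ b + t * + d → a %ℕ d ≡ b %ℕ d
%ℕ-cong d {a} b t a≡b+td =
  n∣∣k-l∣⇒k≡l (n%ℕd<d a d) (n%ℕd<d b d) (divides ∣ e ∣ (begin
    ℕ.∣ ra - rb ∣   ≡⟨ ∣m⊖n∣≡∣m-n∣ ra rb ⟨
    ∣ ra ⊖ rb ∣     ≡⟨ cong ∣_∣ (trans (sym (ℤP.m-n≡m⊖n ra rb)) remainders-differ) ⟩
    ∣ e * + d ∣     ≡⟨ ℤP.abs-* e (+ d) ⟩
    ∣ e ∣ ℕ.* d     ∎))
  where
  open ≡-Reasoning
  ra = a %ℕ d
  rb = b %ℕ d
  qa = a /ℕ d
  qb = b /ℕ d
  e = qb + t - qa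
  remainders-differ : + ra - + rb ≡ e * + d
  remainders-differ = begin
    + ra - + rb                                          ≡⟨ expand (+ ra) (+ rb) qa qb (+ d) ⟩
    (+ ra + qa * + d) - (+ rb + qb * + d) + (qb - qa) * + d
      ≡⟨ cong₂ (λ x y → x - y + (qb - qa) * + d) (a≡a%ℕn+[a/ℕn]*n a d) (a≡a%ℕn+[a/ℕn]*n b d) ⟨
    a - b + (qb - qa) * + d                              ≡⟨ cong (λ x → x - b + (qb - qa) * + d) a≡b+td ⟩
    b + t * + d - b + (qb - qa) * + d                    ≡⟨ collect b t qa qb (+ d) ⟩
    e * + d                                              ∎
    where
    expand : ∀ r s q q′ d → r - s ≡ (r + q * d) - (s + q′ * d) + (q′ - q) * d
    expand = solve-∀
    collect : ∀ b t q q′ d → b + t * d - b + (q′ - q) * d ≡ (q′ + t - q) * d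
    collect = solve-∀

-- Both generators (-1 , 5) and (4 , 1) of M are sent to multiples of 21, and M has index
-- 21 = |det| in ℤ², so residue induces an isomorphism ℤ²/M ≅ ℤ/21.
residue : Point → ℕ
residue (x , y) = (x + + 17 * y) %ℕ 21

residue<21 : ∀ p → residue p < 21
residue<21 (x , y) = n%ℕd<d (x + + 17 * y) 21

residue-⊕ : ∀ p q → residue (p ⊕ q) ≡ (residue p ℕ.+ residue q) ℕ.% 21
residue-⊕ (x , y) (x′ , y′) = %ℕ-cong 21 (+ ru + + rv) (qu + qv) (begin
  (x + x′) + + 17 * (y + y′)            ≡⟨ split x y x′ y′ ⟩
  u + v                                 ≡⟨ cong₂ _+_ (a≡a%ℕn+[a/ℕn]*n u 21) (a≡a%ℕn+[a/ℕn]*n v 21) ⟩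
  (+ ru + qu * + 21) + (+ rv + qv * + 21) ≡⟨ regroup (+ ru) (+ rv) qu qv ⟩
  + ru + + rv + (qu + qv) * + 21        ∎)
  where
  open ≡-Reasoning
  u  = x + + 17 * y
  v  = x′ + + 17 * y′
  ru = u %ℕ 21
  rv = v %ℕ 21
  qu = u /ℕ 21
  qv = v /ℕ 21
  split : ∀ x y x′ y′ → (x + x′) + + 17 * (y + y′) ≡ (x + + 17 * y) + (x′ + + 17 * y′)
  split = solve-∀
  regroup : ∀ r s q q′ → (r + q * + 21) + (s + q′ * + 21) ≡ r + s + (q + q′) * + 21
  regroup = solve-∀

InM⇒residue≡0 : ∀ {m} → InM m → residue m ≡ 0
InM⇒residue≡0 (a , b , refl) = %ℕ-cong 21 (+ 0) (+ 4 * a + b) (generators a b)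
  where
  generators : ∀ a b → (a * -1ℤ + b * + 4) + + 17 * (a * + 5 + b * + 1) ≡ + 0 + (+ 4 * a + b) * + 21
  generators = solve-∀

residue≡0⇒InM : ∀ m → residue m ≡ 0 → InM m
residue≡0⇒InM (x , y) r≡0 =
  y - k , + 5 * k - + 4 * y , cong₂ _,_ first-coordinate (second-coordinate y k)
  where
  open ≡-Reasoning
  k = (x + + 17 * y) /ℕ 21
  first-coordinate : x ≡ (y - k) * -1ℤ + (+ 5 * k - + 4 * y) * + 4
  first-coordinate = begin
    x                             ≡⟨ isolate x y ⟩
    (x + + 17 * y) - + 17 * y     ≡⟨ cong (_- + 17 * y) (a≡a%ℕn+[a/ℕn]*n (x + + 17 * y) 21) ⟩
    (+ residue (x , y) + k * + 21) - + 17 * y ≡⟨ cong (λ r → (+ r + k * + 21) - + 17 * y) r≡0 ⟩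
    (+ 0 + k * + 21) - + 17 * y   ≡⟨ recombine y k ⟩
    (y - k) * -1ℤ + (+ 5 * k - + 4 * y) * + 4 ∎
    where
    isolate : ∀ x y → x ≡ (x + + 17 * y) - + 17 * y
    isolate = solve-∀
    recombine : ∀ y k → (+ 0 + k * + 21) - + 17 * y ≡ (y - k) * -1ℤ + (+ 5 * k - + 4 * y) * + 4
    recombine = solve-∀
  second-coordinate : ∀ y k → y ≡ (y - k) * + 5 + (+ 5 * k - + 4 * y) * + 1
  second-coordinate = solve-∀

centreMod≡residue%3 : ∀ p → centreMod p ≡ residue p ℕ.% 3
centreMod≡residue%3 (x , y) = %ℕ-cong 3 (+ r) (q * + 7 - y * + 6) (begin
  x - y                           ≡⟨ isolate x y ⟩
  (x + + 17 * y) - y * + 18       ≡⟨ cong (_- y * + 18) (a≡a%ℕn+[a/ℕn]*n (x + + 17 * y) 21) ⟩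
  (+ r + q * + 21) - y * + 18     ≡⟨ regroup (+ r) q y ⟩
  + r + (q * + 7 - y * + 6) * + 3 ∎)
  where
  open ≡-Reasoning
  r = residue (x , y)
  q = (x + + 17 * y) /ℕ 21
  isolate : ∀ x y → x - y ≡ (x + + 17 * y) - y * + 18
  isolate = solve-∀
  regroup : ∀ r q y → (r + q * + 21) - y * + 18 ≡ r + (q * + 7 - y * + 6) * + 3
  regroup = solve-∀

cornerᵇ : ℕ → Bool
cornerᵇ c = not (c ℕ.% 3 ℕ.≡ᵇ 0)

isCorner≡cornerᵇ-residue : ∀ p → isCorner p ≡ cornerᵇ (residue p)
isCorner≡cornerᵇ-residue p =
  trans isCorner-centreMod (cong (λ c → not (c ℕ.≡ᵇ 0)) (centreMod≡residue%3 p))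
  where
  isCorner-centreMod : isCorner p ≡ not (centreMod p ℕ.≡ᵇ 0)
  isCorner-centreMod with centreMod p
  ... | zero  = refl
  ... | suc _ = refl

⊕-assoc : ∀ p q v → p ⊕ q ⊕ v ≡ p ⊕ (q ⊕ v)
⊕-assoc (a , b) (c , d) (e , f) = cong₂ _,_ (ℤP.+-assoc a c e) (ℤP.+-assoc b d f)

⊕-cancelˡ : ∀ m {u v} → m ⊕ u ≡ m ⊕ v → u ≡ v
⊕-cancelˡ (a , b) eq = cong₂ _,_ (∙-cancelˡ a _ _ (cong proj₁ eq)) (∙-cancelˡ b _ _ (cong proj₂ eq))

residue-translate : ∀ {m} → InM m → ∀ v → residue (m ⊕ v) ≡ residue v
residue-translate {m} m∈M v = begin
  residue (m ⊕ v)                   ≡⟨ residue-⊕ m v ⟩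
  (residue m ℕ.+ residue v) ℕ.% 21  ≡⟨ cong (λ r → (r ℕ.+ residue v) ℕ.% 21) (InM⇒residue≡0 m∈M) ⟩
  residue v ℕ.% 21                  ≡⟨ m<n⇒m%n≡m (residue<21 v) ⟩
  residue v                         ∎
  where open ≡-Reasoning

≡residue⇒translate : ∀ {p} u → residue p ≡ residue u → ∃[ m ] InM m × p ≡ m ⊕ u
≡residue⇒translate {p} u rp≡ru = m , residue≡0⇒InM m residue-m , sym (undo p u)
  where
  open ≡-Reasoning
  m = p ⊕ -1ℤ · u
  cancel : ∀ a c → a + -1ℤ * c + c ≡ a
  cancel = solve-∀
  undo : ∀ p u → p ⊕ -1ℤ · u ⊕ u ≡ p
  undo (a , b) (c , d) = cong₂ _,_ (cancel a c) (cancel b d)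
  inverse : ∀ u → u ⊕ -1ℤ · u ≡ (+ 0 , + 0)
  inverse (c , d) = cong₂ _,_ (vanish c) (vanish d)
    where
    vanish : ∀ c → c + -1ℤ * c ≡ + 0
    vanish = solve-∀
  residue-m : residue m ≡ 0
  residue-m = begin
    residue m                                 ≡⟨ residue-⊕ p (-1ℤ · u) ⟩
    (residue p ℕ.+ residue (-1ℤ · u)) ℕ.% 21  ≡⟨ cong (λ r → (r ℕ.+ residue (-1ℤ · u)) ℕ.% 21) rp≡ru ⟩
    (residue u ℕ.+ residue (-1ℤ · u)) ℕ.% 21  ≡⟨ residue-⊕ u (-1ℤ · u) ⟨
    residue (u ⊕ -1ℤ · u)                     ≡⟨ cong residue (inverse u) ⟩
    residue (+ 0 , + 0)                       ∎

≡residue⇒translate-edge : ∀ {p} u j → residue p ≡ residue u →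
                          ∃[ m ] InM m × p ≡ m ⊕ u × p ⊕ δ j ≡ m ⊕ (u ⊕ δ j)
≡residue⇒translate-edge u j rp≡ru =
  let m , m∈M , p≡m⊕u = ≡residue⇒translate u rp≡ru
  in  m , m∈M , p≡m⊕u , trans (cong (_⊕ δ j) p≡m⊕u) (⊕-assoc m u (δ j))

translate-edge⇒≡residue : ∀ {m p u v} j → InM m → p ≡ m ⊕ u → p ⊕ δ j ≡ m ⊕ v →
                          residue p ≡ residue u × u ⊕ δ j ≡ v
translate-edge⇒≡residue {m} {u = u} j m∈M refl q≡m⊕v =
  residue-translate m∈M u , ⊕-cancelˡ m (trans (sym (⊕-assoc m u (δ j))) q≡m⊕v)

next² opposite prev² : Fin 6 → Fin 6
next² i    = next (next i)
opposite i = next (next² i)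
prev² i    = next (opposite i)

infix 4 _≟ₚ_
_≟ₚ_ : DecidableEquality Point
_≟ₚ_ = ≡-dec ℤ._≟_ ℤ._≟_

forward-side-step : ∀ j → δ (prev² j) ⊕ δ j ≡ δ (next (prev² j))
forward-side-step = from-yes (all? λ j → δ (prev² j) ⊕ δ j ≟ₚ δ (next (prev² j)))

forward-side-unique : ∀ i j → δ i ⊕ δ j ≡ δ (next i) → i ≡ prev² j
forward-side-unique =
  from-yes (all? λ i → all? λ j → (δ i ⊕ δ j ≟ₚ δ (next i)) →-dec (i ≟ᶠ prev² j))

backward-side-step : ∀ j → δ (next² j) ⊕ δ j ≡ δ (next j)
backward-side-step = from-yes (all? λ j → δ (next² j) ⊕ δ j ≟ₚ δ (next j))

backward-side-unique : ∀ i j → δ (next i) ⊕ δ j ≡ δ i → next i ≡ next² j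
backward-side-unique =
  from-yes (all? λ i → all? λ j → (δ (next i) ⊕ δ j ≟ₚ δ i) →-dec (next i ≟ᶠ next² j))

outward-spoke-unique : ∀ i j → δ i ⊕ δ j ≡ δ i ⊕ δ i → i ≡ j
outward-spoke-unique =
  from-yes (all? λ i → all? λ j → (δ i ⊕ δ j ≟ₚ δ i ⊕ δ i) →-dec (i ≟ᶠ j))

inward-spoke-step : ∀ j → δ (opposite j) ⊕ δ (opposite j) ⊕ δ j ≡ δ (opposite j)
inward-spoke-step =
  from-yes (all? λ j → δ (opposite j) ⊕ δ (opposite j) ⊕ δ j ≟ₚ δ (opposite j))

inward-spoke-unique : ∀ i j → δ i ⊕ δ i ⊕ δ j ≡ δ i → i ≡ opposite j
inward-spoke-unique =
  from-yes (all? λ i → all? λ j → (δ i ⊕ δ i ⊕ δ j ≟ₚ δ i) →-dec (i ≟ᶠ opposite j))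

forward-side : ∀ {p} j → residue p ≡ residue (δ (prev² j)) → CentralSide p (p ⊕ δ j)
forward-side j e =
  let m , m∈M , p≡ , q≡ = ≡residue⇒translate-edge (δ (prev² j)) j e
  in  m , prev² j , m∈M , inj₁ (p≡ , trans q≡ (cong (m ⊕_) (forward-side-step j)))

backward-side : ∀ {p} j → residue p ≡ residue (δ (next² j)) → CentralSide p (p ⊕ δ j)
backward-side j e =
  let m , m∈M , p≡ , q≡ = ≡residue⇒translate-edge (δ (next² j)) j e
  in  m , next j , m∈M , inj₂ (p≡ , trans q≡ (cong (m ⊕_) (backward-side-step j)))

¬central-side : ∀ {p} j → residue p ≢ residue (δ (prev² j)) → residue p ≢ residue (δ (next² j)) →
                ¬ CentralSide p (p ⊕ δ j)
¬central-side j ¬fwd ¬bwd (m , i , m∈M , inj₁ (p≡ , q≡)) =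
  let rp , step = translate-edge⇒≡residue j m∈M p≡ q≡
  in  ¬fwd (trans rp (cong (λ k → residue (δ k)) (forward-side-unique i j step)))
¬central-side j ¬fwd ¬bwd (m , i , m∈M , inj₂ (p≡ , q≡)) =
  let rp , step = translate-edge⇒≡residue j m∈M p≡ q≡
  in  ¬bwd (trans rp (cong (λ k → residue (δ k)) (backward-side-unique i j step)))

¬spoke : ∀ {p} j → residue p ≢ residue (δ j) →
         residue p ≢ residue (δ (opposite j) ⊕ δ (opposite j)) → ¬ IsSpoke p (p ⊕ δ j)
¬spoke j ¬out ¬in (m , i , m∈M , inj₁ (p≡ , q≡)) =
  let rp , step = translate-edge⇒≡residue j m∈M p≡ (trans q≡ (⊕-assoc m (δ i) (δ i)))
  in  ¬out (trans rp (cong (λ k → residue (δ k)) (outward-spoke-unique i j step)))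
¬spoke j ¬out ¬in (m , i , m∈M , inj₂ (p≡ , q≡)) =
  let rp , step = translate-edge⇒≡residue j m∈M (trans p≡ (⊕-assoc m (δ i) (δ i))) q≡
  in  ¬in (trans rp (cong (λ k → residue (δ k ⊕ δ k)) (inward-spoke-unique i j step)))

weightTable : Bool → ℕ → Fin 6 → ℕ
weightTable b c j with c ≟ residue (δ (prev² j)) | c ≟ residue (δ (next² j))
                     | c ≟ residue (δ j) | c ≟ residue (δ (opposite j) ⊕ δ (opposite j))
... | yes _ | _     | _     | _     = 2
... | no _  | yes _ | _     | _     = 2
... | no _  | no _  | yes _ | _     = spokeWeight b j
... | no _  | no _  | no _  | yes _ = spokeWeight b (opposite j)
... | no _  | no _  | no _  | no _  = 1

spokeWeight∈23 : ∀ b i → spokeWeight b i ≡ 2 ⊎ spokeWeight b i ≡ 3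
spokeWeight∈23 true  i with evenIdx i
... | true  = inj₁ refl
... | false = inj₂ refl
spokeWeight∈23 false i with evenIdx i
... | true  = inj₂ refl
... | false = inj₁ refl

weightTable∈123 : ∀ b c j → weightTable b c j ≡ 1 ⊎ weightTable b c j ≡ 2 ⊎ weightTable b c j ≡ 3
weightTable∈123 b c j with c ≟ residue (δ (prev² j)) | c ≟ residue (δ (next² j))
                         | c ≟ residue (δ j) | c ≟ residue (δ (opposite j) ⊕ δ (opposite j))
... | yes _ | _     | _     | _     = inj₂ (inj₁ refl)
... | no _  | yes _ | _     | _     = inj₂ (inj₁ refl)
... | no _  | no _  | yes _ | _     = inj₂ (spokeWeight∈23 b j)
... | no _  | no _  | no _  | yes _ = inj₂ (spokeWeight∈23 b (opposite j))
... | no _  | no _  | no _  | no _  = inj₁ refl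

sum₆ : (Fin 6 → ℕ) → ℕ
sum₆ f = f zero ℕ.+ f (suc zero) ℕ.+ f (suc (suc zero)) ℕ.+ f (suc (suc (suc zero)))
         ℕ.+ f (suc (suc (suc (suc zero)))) ℕ.+ f (suc (suc (suc (suc (suc zero)))))

sum₆-cong : ∀ {f g} → (∀ j → f j ≡ g j) → sum₆ f ≡ sum₆ g
sum₆-cong f≗g = cong₂ ℕ._+_ (cong₂ ℕ._+_ (cong₂ ℕ._+_ (cong₂ ℕ._+_ (cong₂ ℕ._+_
  (f≗g _) (f≗g _)) (f≗g _)) (f≗g _)) (f≗g _)) (f≗g _)

if-cong : ∀ {x y} {m n : ℕ} → x ≡ y → (x ≡ true → m ≡ n) →
          (if x then m else 0) ≡ (if y then n else 0)
if-cong {true}  refl m≡n = m≡n refl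
if-cong {false} refl _   = refl

neighbourResidue : ℕ → Fin 6 → ℕ
neighbourResidue c j = (c ℕ.+ residue (δ j)) ℕ.% 21

isCorner-neighbour : ∀ p j → isCorner (p ⊕ δ j) ≡ cornerᵇ (neighbourResidue (residue p) j)
isCorner-neighbour p j = trans (isCorner≡cornerᵇ-residue (p ⊕ δ j)) (cong cornerᵇ (residue-⊕ p (δ j)))

degreeTable : Bool → ℕ → ℕ
degreeTable b c = sum₆ λ j → if cornerᵇ (neighbourResidue c j) then weightTable b c j else 0

AdjacentDegreesDiffer : Bool → ℕ → Fin 6 → Set
AdjacentDegreesDiffer b c j =
  cornerᵇ c ≡ true → cornerᵇ (neighbourResidue c j) ≡ true →
  degreeTable b c ≢ degreeTable b (neighbourResidue c j)

adjacentDegreesDiffer? : ∀ b c j → Dec (AdjacentDegreesDiffer b c j)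
adjacentDegreesDiffer? b c j =
  (cornerᵇ c Bool.≟ true) →-dec (cornerᵇ (neighbourResidue c j) Bool.≟ true) →-dec
  ¬? (degreeTable b c ≟ degreeTable b (neighbourResidue c j))

adjacentDegreesDiffer : ∀ b {c} → c < 21 → ∀ j → AdjacentDegreesDiffer b c j
adjacentDegreesDiffer true  = from-yes (ℕP.allUpTo? (λ c → all? (adjacentDegreesDiffer? true c)) 21)
adjacentDegreesDiffer false = from-yes (ℕP.allUpTo? (λ c → all? (adjacentDegreesDiffer? false c)) 21)

module PaperWeighting (w : Point → Point → ℕ) (b : Bool)
  (central : ∀ p q → Adj p q → CentralSide p q → w p q ≡ 2)
  (spoke : ∀ m i → InM m → w (m ⊕ δ i) (spokeEnd m i) ≡ spokeWeight b i
                         × w (spokeEnd m i) (m ⊕ δ i) ≡ spokeWeight b i)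
  (other : ∀ p q → Adj p q → ¬ CentralSide p q → ¬ IsSpoke p q → w p q ≡ 1) where

  outward-spoke-weight : ∀ {p} j → residue p ≡ residue (δ j) → w p (p ⊕ δ j) ≡ spokeWeight b j
  outward-spoke-weight j e =
    let m , m∈M , p≡ = ≡residue⇒translate (δ j) e
    in  trans (cong₂ w p≡ (cong (_⊕ δ j) p≡)) (proj₁ (spoke m j m∈M))

  inward-spoke-weight : ∀ {p} j → residue p ≡ residue (δ (opposite j) ⊕ δ (opposite j)) →
                        w p (p ⊕ δ j) ≡ spokeWeight b (opposite j)
  inward-spoke-weight j e =
    let i = opposite j
        m , m∈M , p≡ , q≡ = ≡residue⇒translate-edge (δ i ⊕ δ i) j e
        p≡spokeEnd = trans p≡ (sym (⊕-assoc m (δ i) (δ i)))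
        q≡corner   = trans q≡ (cong (m ⊕_) (inward-spoke-step j))
    in  trans (cong₂ w p≡spokeEnd q≡corner) (proj₂ (spoke m i m∈M))

  edge-weight : ∀ {p} j → IsCorner p → IsCorner (p ⊕ δ j) →
                w p (p ⊕ δ j) ≡ weightTable b (residue p) j
  edge-weight {p} j cp cq
    with residue p ≟ residue (δ (prev² j)) | residue p ≟ residue (δ (next² j))
       | residue p ≟ residue (δ j) | residue p ≟ residue (δ (opposite j) ⊕ δ (opposite j))
  ... | yes e  | _      | _       | _      = central p _ (cp , cq , j , refl) (forward-side j e)
  ... | no _   | yes e  | _       | _      = central p _ (cp , cq , j , refl) (backward-side j e)
  ... | no _   | no _   | yes e   | _      = outward-spoke-weight j e
  ... | no _   | no _   | no _    | yes e  = inward-spoke-weight j e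
  ... | no ¬fw | no ¬bw | no ¬out | no ¬in =
    other p _ (cp , cq , j , refl) (¬central-side j ¬fw ¬bw) (¬spoke j ¬out ¬in)

  degree : ∀ p → IsCorner p → s w p ≡ degreeTable b (residue p)
  degree p cp = sum₆-cong λ j → if-cong (isCorner-neighbour p j) (edge-weight {p} j cp)

  weight∈123 : ∀ p q → Adj p q → w p q ≡ 1 ⊎ w p q ≡ 2 ⊎ w p q ≡ 3
  weight∈123 p _ (cp , cq , j , refl) =
    subst (λ n → n ≡ 1 ⊎ n ≡ 2 ⊎ n ≡ 3) (sym (edge-weight j cp cq))
          (weightTable∈123 b (residue p) j)

  adjacent-degrees-differ : ∀ p q → Adj p q → s w p ≢ s w q
  adjacent-degrees-differ p _ (cp , cq , j , refl) s≡ =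
    adjacentDegreesDiffer b (residue<21 p) j
      (trans (sym (isCorner≡cornerᵇ-residue p)) cp)
      (trans (sym (isCorner-neighbour p j)) cq)
      (begin
        degreeTable b (residue p)                       ≡⟨ degree p cp ⟨
        s w p                                           ≡⟨ s≡ ⟩
        s w (p ⊕ δ j)                                   ≡⟨ degree (p ⊕ δ j) cq ⟩
        degreeTable b (residue (p ⊕ δ j))               ≡⟨ cong (degreeTable b) (residue-⊕ p (δ j)) ⟩
        degreeTable b (neighbourResidue (residue p) j)  ∎)
    where open ≡-Reasoning

proposition3p5 : (w : Point → Point → ℕ) → IsPaperWeighting w → Solution123 w
proposition3p5 w (b , central , spoke , other) = weight∈123 , adjacent-degrees-differ
  where open PaperWeighting w b central spoke other
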